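{- For every graph $G$ and every 2-switch $\tau$ on $G$, $|\omega(\tau(G))-\omega(G)|\le 1$, where $\omega$ denotes the clique number.
   Context: Graphs are finite and simple. A 2-switch on $G$ is specified by four distinct vertices $a,b,c,d$ with $ab,cd\in E(G)$ and $ac,bd\notin E(G)$; it produces $\tau(G)=G-ab-cd+ac+bd$. $\omega(G)$ is the maximum size of a set of pairwise adjacent vertices of $G$. -}

module Defs where

open import Data.Nat using (ℕ; zero; suc; _⊔_)
open import Data.Bool using (Bool; true; false; _∧_; _∨_; not; if_then_else_; T)
open import Data.Fin using (Fin; _≟_)
open import Data.Fin.Subset using (Subset; ∣_∣)
open import Data.Vec using (Vec; []; _∷_; lookup)
open import Data.List using (List; []; _∷_; map; _++_; foldr; allFin)
open import Data.Bool.ListAction using (all)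
open import Data.Product using (_×_)
open import Relation.Binary.PropositionalEquality using (_≡_; _≢_)
open import Relation.Nullary using (¬_; yes; no)
open import Relation.Nullary.Decidable using (⌊_⌋)

record Graph (n : ℕ) : Set where
  field
    adj    : Fin n → Fin n → Bool
    sym    : ∀ u v → adj u v ≡ adj v u
    irrefl : ∀ v → adj v v ≡ false
open Graph public

Edge : ∀ {n} → Graph n → Fin n → Fin n → Set
Edge G u v = T (adj G u v)

subsets : (n : ℕ) → List (Subset n)
subsets zero    = [] ∷ []
subsets (suc n) = map (false ∷_) (subsets n) ++ map (true ∷_) (subsets n)

-- S is a clique: any two distinct members of S are adjacent.
-- (stated for an adjacency relation, so it applies to τ(G) as well)
isClique : ∀ {n} → (Fin n → Fin n → Bool) → Subset n → Bool
isClique {n} E S =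
  all (λ u → all (λ v →
        not (lookup S u) ∨ not (lookup S v) ∨ ⌊ u ≟ v ⌋ ∨ E u v)
      (allFin n)) (allFin n)

ωAdj : ∀ {n} → (Fin n → Fin n → Bool) → ℕ
ωAdj {n} E = foldr (λ S m → (if isClique E S then ∣ S ∣ else 0) ⊔ m) 0 (subsets n)

ω : ∀ {n} → Graph n → ℕ
ω G = ωAdj (adj G)

record TwoSwitch {n : ℕ} (G : Graph n) : Set where
  field
    a b c d : Fin n
    a≢b : a ≢ b
    a≢c : a ≢ c
    a≢d : a ≢ d
    b≢c : b ≢ c
    b≢d : b ≢ d
    c≢d : c ≢ d
    ab∈E : Edge G a b
    cd∈E : Edge G c d
    ac∉E : ¬ Edge G a c
    bd∉E : ¬ Edge G b d
open TwoSwitch public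

samePair : ∀ {n} → Fin n → Fin n → Fin n → Fin n → Bool
samePair u v x y = (⌊ u ≟ x ⌋ ∧ ⌊ v ≟ y ⌋) ∨ (⌊ u ≟ y ⌋ ∧ ⌊ v ≟ x ⌋)

switchAdj : ∀ {n} (G : Graph n) → TwoSwitch G → Fin n → Fin n → Bool
switchAdj G t u v =
  if samePair u v (a t) (b t) ∨ samePair u v (c t) (d t) then false
  else if samePair u v (a t) (c t) ∨ samePair u v (b t) (d t) then true
  else adj G u v

ωτ : ∀ {n} (G : Graph n) → TwoSwitch G → ℕ
ωτ G t = ωAdj (switchAdj G t)

{-# OPTIONS --safe #-}
-- Both directions are one lemma. Let E, F be adjacency relations such that every
-- E-edge outside F is one of the pairs pq, rs, and p, r are distinct and
-- non-adjacent in E. An E-clique S cannot contain both pairs: if p, q ∈ S then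
-- r ∉ S, and S - p is an F-clique; otherwise S - r is. Hence ω(E) ≤ ω(F) + 1.
-- For τ(G) against G take the new edges ac, bd with τ(G) lacking ab; for G against
-- τ(G) take the removed edges ab, cd with G lacking ac.
module Submission where

open import Defs
open import Data.Bool using (Bool; true; false; _∧_; _∨_; not; if_then_else_; T)
open import Data.Bool.ListAction using (all)
open import Data.Bool.Properties using (T-≡; T-∧; T-∨)
open import Data.Fin using (Fin; zero; suc; _≟_)
open import Data.Fin.Subset using (Subset; inside; outside; _∈_; _∉_; _⊆_; _-_; _∪_; ⁅_⁆; ∣_∣)
open import Data.Fin.Subset.Properties using (_∈?_; drop-there; x∈⁅x⁆; x∈p∧x≢y⇒x∈p-y; p─q⊆p; p⊆p∪q; q⊆p∪q; ∪-identityʳ; p⊆q⇒∣p∣≤∣q∣)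
open import Data.List using ([]; _∷_; map; foldr; allFin)
open import Data.List.Membership.Propositional using () renaming (_∈_ to _∈ᴸ_)
open import Data.List.Membership.Propositional.Properties using (∈-map⁺; ∈-++⁺ˡ; ∈-++⁺ʳ)
open import Data.List.Relation.Unary.All.Properties using (all⁺; all⁻; tabulate⁺; tabulate⁻)
open import Data.List.Relation.Unary.Any using (here; there)
open import Data.Nat using (ℕ; suc; _≤_; _⊔_; z≤n; s≤s)
open import Data.Nat.Properties using (≤-refl; ≤-trans; n≤1+n; m≤m⊔n; m≤n⊔m; ⊔-lub)
open import Data.Product using (_×_; _,_; proj₁; proj₂; ∃-syntax)
import Data.Product as Product
open import Data.Sum using (_⊎_; inj₁; inj₂)
import Data.Sum as Sum
open import Data.Vec using ([]; _∷_; lookup)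
open import Data.Vec.Properties using ([]=↔lookup)
open import Data.Empty using (⊥-elim)
open import Function using (_∘_)
open import Function.Bundles using (_⇔_; mk⇔; Equivalence; Inverse)
open import Relation.Binary.PropositionalEquality using (_≡_; _≢_; refl)
open import Relation.Nullary using (¬_; Dec; yes; no; contradiction)
open import Relation.Nullary.Decidable using (⌊_⌋; toWitness; fromWitness)

open Equivalence using (to; from)

private
  variable
    n : ℕ

Adjacency : ℕ → Set
Adjacency n = Fin n → Fin n → Bool

IsClique : Adjacency n → Subset n → Set
IsClique E S = ∀ {u v} → u ∈ S → v ∈ S → u ≢ v → T (E u v)

SamePair : Fin n → Fin n → Fin n → Fin n → Set
SamePair u v x y = (u ≡ x × v ≡ y) ⊎ (u ≡ y × v ≡ x)

SamePair⇒∈ : ∀ {S : Subset n} {u v x y} → SamePair u v x y → u ∈ S → v ∈ S → x ∈ S × y ∈ S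
SamePair⇒∈ (inj₁ (refl , refl)) u∈S v∈S = u∈S , v∈S
SamePair⇒∈ (inj₂ (refl , refl)) u∈S v∈S = v∈S , u∈S

x∉p-x : ∀ (p : Subset n) x → x ∉ p - x
x∉p-x (s ∷ p) zero    ()
x∉p-x (s ∷ p) (suc x) = x∉p-x p x ∘ drop-there

∣p∪⁅x⁆∣≤1+∣p∣ : ∀ (p : Subset n) x → ∣ p ∪ ⁅ x ⁆ ∣ ≤ suc ∣ p ∣
∣p∪⁅x⁆∣≤1+∣p∣ (outside ∷ p) zero    rewrite ∪-identityʳ p = ≤-refl
∣p∪⁅x⁆∣≤1+∣p∣ (inside  ∷ p) zero    rewrite ∪-identityʳ p = n≤1+n _
∣p∪⁅x⁆∣≤1+∣p∣ (outside ∷ p) (suc x) = ∣p∪⁅x⁆∣≤1+∣p∣ p x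
∣p∪⁅x⁆∣≤1+∣p∣ (inside  ∷ p) (suc x) = s≤s (∣p∪⁅x⁆∣≤1+∣p∣ p x)

p⊆p-x∪⁅x⁆ : ∀ (p : Subset n) x → p ⊆ (p - x) ∪ ⁅ x ⁆
p⊆p-x∪⁅x⁆ p x {y} y∈p with y ≟ x
... | yes refl = q⊆p∪q (p - x) ⁅ x ⁆ (x∈⁅x⁆ x)
... | no y≢x   = p⊆p∪q ⁅ x ⁆ (x∈p∧x≢y⇒x∈p-y y∈p y≢x)

∣p∣≤1+∣p-x∣ : ∀ (p : Subset n) x → ∣ p ∣ ≤ suc ∣ p - x ∣
∣p∣≤1+∣p-x∣ p x = ≤-trans (p⊆q⇒∣p∣≤∣q∣ (p⊆p-x∪⁅x⁆ p x)) (∣p∪⁅x⁆∣≤1+∣p∣ (p - x) x)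

∈⇔T-lookup : ∀ {S : Subset n} {u} → u ∈ S ⇔ T (lookup S u)
∈⇔T-lookup = mk⇔ (from T-≡ ∘ Inverse.to []=↔lookup) (Inverse.from []=↔lookup ∘ to T-≡)

T-all-allFin : ∀ (p : Fin n → Bool) → T (all p (allFin n)) ⇔ (∀ i → T (p i))
T-all-allFin p = mk⇔ (tabulate⁻ ∘ all⁺ p _) (all⁻ p ∘ tabulate⁺)

T-cliqueCondition : ∀ x y {A : Set} (a? : Dec A) w →
                    T (not x ∨ not y ∨ ⌊ a? ⌋ ∨ w) ⇔ (T x → T y → ¬ A → T w)
T-cliqueCondition false _    _       _ = mk⇔ (λ _ ()) _
T-cliqueCondition true  false _      _ = mk⇔ (λ _ _ ()) _
T-cliqueCondition true  true (yes a) _ = mk⇔ (λ _ _ _ ¬a → contradiction a ¬a) _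
T-cliqueCondition true  true (no ¬a) _ = mk⇔ (λ w _ _ _ → w) (λ h → h _ _ ¬a)

T-isClique : ∀ (E : Adjacency n) S → T (isClique E S) ⇔ IsClique E S
T-isClique E S = mk⇔
  (λ K {u} {v} u∈S v∈S u≢v →
     to (T-cliqueCondition _ _ (u ≟ v) _)
        (to (T-all-allFin _) (to (T-all-allFin _) K u) v)
        (to ∈⇔T-lookup u∈S) (to ∈⇔T-lookup v∈S) u≢v)
  (λ K → from (T-all-allFin _) λ u → from (T-all-allFin _) λ v →
     from (T-cliqueCondition _ _ (u ≟ v) _)
       λ u∈S v∈S → K (from ∈⇔T-lookup u∈S) (from ∈⇔T-lookup v∈S))

∈-subsets : ∀ (S : Subset n) → S ∈ᴸ subsets n
∈-subsets []                  = here refl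
∈-subsets {suc n} (false ∷ S) = ∈-++⁺ˡ (∈-map⁺ (false ∷_) (∈-subsets S))
∈-subsets {suc n} (true  ∷ S) = ∈-++⁺ʳ (map (false ∷_) (subsets n)) (∈-map⁺ (true ∷_) (∈-subsets S))

module _ {A : Set} (f : A → ℕ) where

  ≤-foldr-⊔ : ∀ {x xs} → x ∈ᴸ xs → f x ≤ foldr (λ y m → f y ⊔ m) 0 xs
  ≤-foldr-⊔                (here refl)  = m≤m⊔n _ _
  ≤-foldr-⊔ {xs = y ∷ _} (there x∈xs) = ≤-trans (≤-foldr-⊔ x∈xs) (m≤n⊔m (f y) _)

  foldr-⊔-≤ : ∀ {k} xs → (∀ x → f x ≤ k) → foldr (λ y m → f y ⊔ m) 0 xs ≤ k
  foldr-⊔-≤ []       _   = z≤n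
  foldr-⊔-≤ (x ∷ xs) f≤k = ⊔-lub (f≤k x) (foldr-⊔-≤ xs f≤k)

≤-if-then-else-0 : ∀ {b m} → T b → m ≤ (if b then m else 0)
≤-if-then-else-0 {true} _ = ≤-refl

if-then-else-0-≤ : ∀ {b m k} → (T b → m ≤ k) → (if b then m else 0) ≤ k
if-then-else-0-≤ {true}  m≤k = m≤k _
if-then-else-0-≤ {false} _   = z≤n

clique≤ωAdj : ∀ {E : Adjacency n} {S} → IsClique E S → ∣ S ∣ ≤ ωAdj E
clique≤ωAdj {E = E} {S} K =
  ≤-trans (≤-if-then-else-0 (from (T-isClique E S) K)) (≤-foldr-⊔ _ (∈-subsets S))

ωAdj-lub : ∀ {E : Adjacency n} {k} → (∀ {S} → IsClique E S → ∣ S ∣ ≤ k) → ωAdj E ≤ k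
ωAdj-lub {E = E} bound = foldr-⊔-≤ _ (subsets _) λ S → if-then-else-0-≤ (bound ∘ to (T-isClique E S))

ωAdj≤1+ωAdj : ∀ {E F : Adjacency n} → (∀ {S} → IsClique E S → ∃[ x ] IsClique F (S - x)) →
              ωAdj E ≤ suc (ωAdj F)
ωAdj≤1+ωAdj deletion = ωAdj-lub λ {S} K →
  let x , K-x = deletion K in ≤-trans (∣p∣≤1+∣p-x∣ S x) (s≤s (clique≤ωAdj K-x))

module _ {E F : Adjacency n} {p q r s : Fin n} (p≢r : p ≢ r) (p≁r : ¬ T (E p r))
         (E⊆F∪pq∪rs : ∀ u v → T (E u v) → T (F u v) ⊎ SamePair u v p q ⊎ SamePair u v r s)
         where

  private
    minus-clique : ∀ {S} x → IsClique E S →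
                   ¬ (p ∈ S - x × q ∈ S - x) → ¬ (r ∈ S - x × s ∈ S - x) → IsClique F (S - x)
    minus-clique {S} x K ¬pq ¬rs u∈ v∈ u≢v
      with E⊆F∪pq∪rs _ _ (K (p─q⊆p S _ u∈) (p─q⊆p S _ v∈) u≢v)
    ... | inj₁ Fuv          = Fuv
    ... | inj₂ (inj₁ uv≐pq) = ⊥-elim (¬pq (SamePair⇒∈ uv≐pq u∈ v∈))
    ... | inj₂ (inj₂ uv≐rs) = ⊥-elim (¬rs (SamePair⇒∈ uv≐rs u∈ v∈))

  clique-deletion : ∀ {S} → IsClique E S → ∃[ x ] IsClique F (S - x)
  clique-deletion {S} K with p ∈? S | q ∈? S
  ... | yes p∈S | yes _   = p , minus-clique p K (x∉p-x S p ∘ proj₁) (r∉S ∘ p─q⊆p S _ ∘ proj₁)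
    where
    r∉S : r ∉ S
    r∉S r∈S = p≁r (K p∈S r∈S p≢r)
  ... | no p∉S  | _       = r , minus-clique r K (p∉S ∘ p─q⊆p S _ ∘ proj₁) (x∉p-x S r ∘ proj₁)
  ... | yes _   | no q∉S  = r , minus-clique r K (q∉S ∘ p─q⊆p S _ ∘ proj₂) (x∉p-x S r ∘ proj₁)

T-≟∧≟ : ∀ (u v x y : Fin n) → T (⌊ u ≟ x ⌋ ∧ ⌊ v ≟ y ⌋) ⇔ (u ≡ x × v ≡ y)
T-≟∧≟ u v x y = mk⇔
  (Product.map (toWitness {a? = u ≟ x}) (toWitness {a? = v ≟ y}) ∘ to (T-∧ {⌊ u ≟ x ⌋}))
  (from T-∧ ∘ Product.map (fromWitness {a? = u ≟ x}) (fromWitness {a? = v ≟ y}))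

samePair-sound : ∀ {u v x y : Fin n} → T (samePair u v x y) → SamePair u v x y
samePair-sound {u = u} {v} {x} {y} =
  Sum.map (to (T-≟∧≟ u v x y)) (to (T-≟∧≟ u v y x)) ∘ to (T-∨ {⌊ u ≟ x ⌋ ∧ ⌊ v ≟ y ⌋})

samePair-refl : ∀ (x y : Fin n) → T (samePair x y x y)
samePair-refl x y = from T-∨ (inj₁ (from (T-≟∧≟ x y x y) (refl , refl)))

module _ (G : Graph n) (t : TwoSwitch G) where

  switch-removes-ab : ¬ T (switchAdj G t (a t) (b t))
  switch-removes-ab with samePair (a t) (b t) (a t) (b t) | samePair-refl (a t) (b t)
  ... | true  | _  = λ ()
  ... | false | ()

  switch⊆G∪ac∪bd : ∀ u v → T (switchAdj G t u v) →
                   T (adj G u v) ⊎ SamePair u v (a t) (c t) ⊎ SamePair u v (b t) (d t)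
  switch⊆G∪ac∪bd u v uv∈τG with samePair u v (a t) (b t) ∨ samePair u v (c t) (d t)
  switch⊆G∪ac∪bd u v ()     | true
  ... | false with samePair u v (a t) (c t) ∨ samePair u v (b t) (d t) in added
  ...   | true  = inj₂ (Sum.map samePair-sound samePair-sound (to T-∨ (from T-≡ added)))
  ...   | false = inj₁ uv∈τG

  G⊆switch∪ab∪cd : ∀ u v → T (adj G u v) →
                   T (switchAdj G t u v) ⊎ SamePair u v (a t) (b t) ⊎ SamePair u v (c t) (d t)
  G⊆switch∪ab∪cd u v uv∈G with samePair u v (a t) (b t) ∨ samePair u v (c t) (d t) in removed
  ... | true  = inj₂ (Sum.map samePair-sound samePair-sound (to T-∨ (from T-≡ removed)))
  ... | false with samePair u v (a t) (c t) ∨ samePair u v (b t) (d t)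
  ...   | true  = inj₁ _
  ...   | false = inj₁ uv∈G

mainTheorem12 : ∀ {n} (G : Graph n) (t : TwoSwitch G) →
                  (ωτ G t ≤ suc (ω G)) × (ω G ≤ suc (ωτ G t))
mainTheorem12 G t =
  ωAdj≤1+ωAdj (clique-deletion (a≢b t) (switch-removes-ab G t) (switch⊆G∪ac∪bd G t)) ,
  ωAdj≤1+ωAdj (clique-deletion (a≢c t) (ac∉E t) (G⊆switch∪ab∪cd G t))
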